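{- Define oriented graphs $M_i$ recursively: $M_0$ is a single-vertex graph, and for $i\ge 1$, $M_i=M_{i-1}\cup M_{i-1}\cup (M_{i-1}\times M_{i-1})$ (using pairwise vertex-disjoint copies of $M_{i-1}$). Then every msp-digraph $G$ is (isomorphic to) a subdigraph, not necessarily induced, of some $M_i$ such that every source of $G$ is a source of $M_i$ and every sink of $G$ is a sink of $M_i$.
   Context: A source is a vertex of indegree $0$, a sink a vertex of outdegree $0$. For vertex-disjoint digraphs $G_1=(V_1,E_1)$, $G_2=(V_2,E_2)$, let $O_1$ be the set of sinks of $G_1$ and $I_2$ the set of sources of $G_2$. The parallel composition is $G_1\cup G_2=(V_1\cup V_2,E_1\cup E_2)$; the series composition is $G_1\times G_2=(V_1\cup V_2,E_1\cup E_2\cup\{(v,w)\mid v\in O_1, w\in I_2\})$. Minimal series-parallel digraphs (msp-digraphs) are defined recursively: every single-vertex digraph is an msp-digraph, and if $G_1,G_2$ are vertex-disjoint msp-digraphs then $G_1\cup G_2$ and $G_1\times G_2$ are msp-digraphs. A subdigraph of $(V,E)$ is a digraph $(V',E')$ with $V'\subseteq V$, $E'\subseteq E$. -}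

module Defs where

open import Data.Nat using (ℕ; zero; suc)
open import Data.Unit using (⊤)
open import Data.Empty using (⊥)
open import Data.Sum using (_⊎_; inj₁; inj₂)
open import Data.Product using (_×_; Σ; ∃)
open import Relation.Nullary using (¬_)
open import Relation.Binary.PropositionalEquality using (_≡_)

record Digraph : Set₁ where
  field
    V : Set
    E : V → V → Set
open Digraph public

Source : (G : Digraph) → V G → Set
Source G v = ∀ u → ¬ E G u v

Sink : (G : Digraph) → V G → Set
Sink G v = ∀ w → ¬ E G v w

single : Digraph
single = record { V = ⊤ ; E = λ _ _ → ⊥ }

_∪ᴳ_ : Digraph → Digraph → Digraph
G₁ ∪ᴳ G₂ = record { V = V G₁ ⊎ V G₂ ; E = e }
  where
  e : V G₁ ⊎ V G₂ → V G₁ ⊎ V G₂ → Set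
  e (inj₁ x) (inj₁ y) = E G₁ x y
  e (inj₂ x) (inj₂ y) = E G₂ x y
  e (inj₁ x) (inj₂ y) = ⊥
  e (inj₂ x) (inj₁ y) = ⊥

_×ᴳ_ : Digraph → Digraph → Digraph
G₁ ×ᴳ G₂ = record { V = V G₁ ⊎ V G₂ ; E = e }
  where
  e : V G₁ ⊎ V G₂ → V G₁ ⊎ V G₂ → Set
  e (inj₁ x) (inj₁ y) = E G₁ x y
  e (inj₂ x) (inj₂ y) = E G₂ x y
  e (inj₁ x) (inj₂ y) = Sink G₁ x × Source G₂ y
  e (inj₂ x) (inj₁ y) = ⊥

data IsMSP : Digraph → Set₁ where
  msp-single : IsMSP single
  msp-par    : ∀ {G₁ G₂} → IsMSP G₁ → IsMSP G₂ → IsMSP (G₁ ∪ᴳ G₂)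
  msp-ser    : ∀ {G₁ G₂} → IsMSP G₁ → IsMSP G₂ → IsMSP (G₁ ×ᴳ G₂)

M : ℕ → Digraph
M zero    = single
M (suc i) = (M i ∪ᴳ M i) ∪ᴳ (M i ×ᴳ M i)

record SubdigraphEmbedding (G H : Digraph) : Set where
  field
    f         : V G → V H
    injective : ∀ {x y} → f x ≡ f y → x ≡ y
    edges     : ∀ {x y} → E G x y → E H (f x) (f y)
    sources   : ∀ {x} → Source G x → Source H (f x)
    sinks     : ∀ {x} → Sink G x → Sink H (f x)

-- Both compositions act on the disjoint union of vertex sets, so embeddings
-- G₁ ↪ A and G₂ ↪ B combine summand-wise into G₁ ∪ G₂ ↪ A ∪ B and G₁ × G₂ ↪ A × B.
-- In the series case the new edges are preserved because sinks and sources are,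
-- and no vertex of G₂ is a source of G₁ × G₂ (nor one of G₁ a sink) since every
-- msp-digraph has a sink and a source. As M i sits inside M (suc i) as its first
-- summand, two msp-digraphs embed into a common M k, and M (suc k) contains both
-- M k ∪ M k and M k × M k as summands.
module Submission where

open import Defs
open import Data.Empty using (⊥-elim)
open import Data.Nat using (ℕ; zero; suc; _≤_; _≤′_; ≤′-refl; ≤′-step; _⊔_)
open import Data.Nat.Properties using (≤⇒≤′; m≤m⊔n; m≤n⊔m)
open import Data.Product using (Σ; _,_)
open import Data.Sum using (_⊎_; inj₁; inj₂; map)
open import Data.Sum.Properties using (inj₁-injective; inj₂-injective)
open import Data.Unit using (tt)
open import Relation.Nullary using (¬_)
open import Relation.Binary.PropositionalEquality using (_≡_; cong)

open SubdigraphEmbedding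

infix 4 _↪ᴳ_

_↪ᴳ_ : Digraph → Digraph → Set
G ↪ᴳ H = SubdigraphEmbedding G H

↪ᴳ-refl : ∀ {G} → G ↪ᴳ G
↪ᴳ-refl = record
  { f = λ x → x ; injective = λ p → p ; edges = λ e → e
  ; sources = λ s → s ; sinks = λ s → s }

↪ᴳ-trans : ∀ {G H K} → G ↪ᴳ H → H ↪ᴳ K → G ↪ᴳ K
↪ᴳ-trans e₁ e₂ = record
  { f         = λ x → f e₂ (f e₁ x)
  ; injective = λ p → injective e₁ (injective e₂ p)
  ; edges     = λ p → edges e₂ (edges e₁ p)
  ; sources   = λ s → sources e₂ (sources e₁ s)
  ; sinks     = λ s → sinks e₂ (sinks e₁ s) }

module _ {A B : Digraph} where

  ∪-source₁ : ∀ {x} → Source A x → Source (A ∪ᴳ B) (inj₁ x)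
  ∪-source₁ s (inj₁ u) = s u

  ∪-source₂ : ∀ {y} → Source B y → Source (A ∪ᴳ B) (inj₂ y)
  ∪-source₂ s (inj₂ u) = s u

  ∪-sink₁ : ∀ {x} → Sink A x → Sink (A ∪ᴳ B) (inj₁ x)
  ∪-sink₁ s (inj₁ w) = s w

  ∪-sink₂ : ∀ {y} → Sink B y → Sink (A ∪ᴳ B) (inj₂ y)
  ∪-sink₂ s (inj₂ w) = s w

  ×-source₁ : ∀ {x} → Source A x → Source (A ×ᴳ B) (inj₁ x)
  ×-source₁ s (inj₁ u) = s u

  ×-sink₂ : ∀ {y} → Sink B y → Sink (A ×ᴳ B) (inj₂ y)
  ×-sink₂ s (inj₂ w) = s w

  ×-no-source₂ : Σ (V A) (Sink A) → ∀ {y} → ¬ Source (A ×ᴳ B) (inj₂ y)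
  ×-no-source₂ (t , t-sink) s = s (inj₁ t) (t-sink , λ u → s (inj₂ u))

  ×-no-sink₁ : Σ (V B) (Source B) → ∀ {x} → ¬ Sink (A ×ᴳ B) (inj₁ x)
  ×-no-sink₁ (t , t-source) s = s (inj₂ t) ((λ w → s (inj₁ w)) , t-source)

  ∪-inj₁ : A ↪ᴳ A ∪ᴳ B
  ∪-inj₁ = record
    { f = inj₁ ; injective = inj₁-injective ; edges = λ e → e
    ; sources = ∪-source₁ ; sinks = ∪-sink₁ }

  ∪-inj₂ : B ↪ᴳ A ∪ᴳ B
  ∪-inj₂ = record
    { f = inj₂ ; injective = inj₂-injective ; edges = λ e → e
    ; sources = ∪-source₂ ; sinks = ∪-sink₂ }

⊎-map-injective : ∀ {A B C D : Set} {f : A → C} {g : B → D} →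
  (∀ {x y} → f x ≡ f y → x ≡ y) → (∀ {x y} → g x ≡ g y → x ≡ y) →
  ∀ {x y} → map f g x ≡ map f g y → x ≡ y
⊎-map-injective f-inj g-inj {inj₁ x} {inj₁ y} p = cong inj₁ (f-inj (inj₁-injective p))
⊎-map-injective f-inj g-inj {inj₂ x} {inj₂ y} p = cong inj₂ (g-inj (inj₂-injective p))

module _ {G₁ G₂ A B : Digraph} (e₁ : G₁ ↪ᴳ A) (e₂ : G₂ ↪ᴳ B) where

  private
    h : V G₁ ⊎ V G₂ → V A ⊎ V B
    h = map (f e₁) (f e₂)

  ∪-map : G₁ ∪ᴳ G₂ ↪ᴳ A ∪ᴳ B
  ∪-map = record
    { f = h ; injective = ⊎-map-injective (injective e₁) (injective e₂)
    ; edges = λ {x} {y} → edges′ {x} {y} ; sources = λ {x} → sources′ {x} ; sinks = λ {x} → sinks′ {x} }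
    where
    edges′ : ∀ {x y} → E (G₁ ∪ᴳ G₂) x y → E (A ∪ᴳ B) (h x) (h y)
    edges′ {inj₁ _} {inj₁ _} p = edges e₁ p
    edges′ {inj₂ _} {inj₂ _} p = edges e₂ p

    sources′ : ∀ {x} → Source (G₁ ∪ᴳ G₂) x → Source (A ∪ᴳ B) (h x)
    sources′ {inj₁ _} s = ∪-source₁ (sources e₁ λ u → s (inj₁ u))
    sources′ {inj₂ _} s = ∪-source₂ (sources e₂ λ u → s (inj₂ u))

    sinks′ : ∀ {x} → Sink (G₁ ∪ᴳ G₂) x → Sink (A ∪ᴳ B) (h x)
    sinks′ {inj₁ _} s = ∪-sink₁ (sinks e₁ λ w → s (inj₁ w))
    sinks′ {inj₂ _} s = ∪-sink₂ (sinks e₂ λ w → s (inj₂ w))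

  ×-map : Σ (V G₁) (Sink G₁) → Σ (V G₂) (Source G₂) → G₁ ×ᴳ G₂ ↪ᴳ A ×ᴳ B
  ×-map sink₁ source₂ = record
    { f = h ; injective = ⊎-map-injective (injective e₁) (injective e₂)
    ; edges = λ {x} {y} → edges′ {x} {y} ; sources = λ {x} → sources′ {x} ; sinks = λ {x} → sinks′ {x} }
    where
    edges′ : ∀ {x y} → E (G₁ ×ᴳ G₂) x y → E (A ×ᴳ B) (h x) (h y)
    edges′ {inj₁ _} {inj₁ _} p                  = edges e₁ p
    edges′ {inj₂ _} {inj₂ _} p                  = edges e₂ p
    edges′ {inj₁ _} {inj₂ _} (x-sink , y-source) = sinks e₁ x-sink , sources e₂ y-source

    sources′ : ∀ {x} → Source (G₁ ×ᴳ G₂) x → Source (A ×ᴳ B) (h x)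
    sources′ {inj₁ _} s = ×-source₁ (sources e₁ λ u → s (inj₁ u))
    sources′ {inj₂ _} s = ⊥-elim (×-no-source₂ sink₁ s)

    sinks′ : ∀ {x} → Sink (G₁ ×ᴳ G₂) x → Sink (A ×ᴳ B) (h x)
    sinks′ {inj₁ _} s = ⊥-elim (×-no-sink₁ source₂ s)
    sinks′ {inj₂ _} s = ×-sink₂ (sinks e₂ λ w → s (inj₂ w))

msp-source : ∀ {G} → IsMSP G → Σ (V G) (Source G)
msp-source msp-single    = tt , λ _ ()
msp-source (msp-par p _) with msp-source p
... | s , s-source = inj₁ s , ∪-source₁ s-source
msp-source (msp-ser p _) with msp-source p
... | s , s-source = inj₁ s , ×-source₁ s-source

msp-sink : ∀ {G} → IsMSP G → Σ (V G) (Sink G)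
msp-sink msp-single    = tt , λ _ ()
msp-sink (msp-par p _) with msp-sink p
... | t , t-sink = inj₁ t , ∪-sink₁ t-sink
msp-sink (msp-ser _ q) with msp-sink q
... | t , t-sink = inj₂ t , ×-sink₂ t-sink

M-mono : ∀ {i j} → i ≤′ j → M i ↪ᴳ M j
M-mono ≤′-refl      = ↪ᴳ-refl
M-mono (≤′-step p) = ↪ᴳ-trans (M-mono p) (↪ᴳ-trans ∪-inj₁ ∪-inj₁)

M-raise : ∀ {G i j} → i ≤ j → G ↪ᴳ M i → G ↪ᴳ M j
M-raise i≤j e = ↪ᴳ-trans e (M-mono (≤⇒≤′ i≤j))

lemma5p6 : (G : Digraph) → IsMSP G → Σ ℕ (λ i → SubdigraphEmbedding G (M i))
lemma5p6 _ msp-single = zero , ↪ᴳ-refl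
lemma5p6 _ (msp-par p q) with lemma5p6 _ p | lemma5p6 _ q
... | i , e₁ | j , e₂ =
  suc (i ⊔ j) , ↪ᴳ-trans (∪-map (M-raise (m≤m⊔n i j) e₁) (M-raise (m≤n⊔m i j) e₂)) ∪-inj₁
lemma5p6 _ (msp-ser p q) with lemma5p6 _ p | lemma5p6 _ q
... | i , e₁ | j , e₂ =
  suc (i ⊔ j) , ↪ᴳ-trans (×-map (M-raise (m≤m⊔n i j) e₁) (M-raise (m≤n⊔m i j) e₂)
                                (msp-sink p) (msp-source q)) ∪-inj₂
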